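{- Let $\mathcal{G}$ be an ordered group satisfying GOG1 and let $g\in\mathcal{G}\setminus\{1\}$. Then the set $\{h\in\mathcal{G}\setminus\{1\}: h\sim g\}$ is convex in $(\mathcal{G},<)$.
   Context: An ordered group is a group $(\mathcal{G},\cdot,1)$ with a linear order $<$ such that $g>h$ implies $fg>fh$ and $gf>hf$ for all $f$. $\mathcal{C}(g)=\{h: hg=gh\}$, $\mathcal{G}^{>}=\{f: f>1\}$. GOG1: for all $f,g\in\mathcal{G}^{>}$ with $f\geqslant g$ and all $g_0\in\mathcal{C}(g)$ there is $f_0\in\mathcal{C}(f)$ with $f_0\geqslant g_0$. For $f,g\in\mathcal{G}$: $f\preccurlyeq g$ holds if $f=1$, or if $g\neq 1$ and there are $g_0,g_1\in\mathcal{C}(g)$ with $g_0\leqslant f\leqslant g_1$; $f\prec g$ means $f\preccurlyeq g$ and not $g\preccurlyeq f$. For $g,h\neq 1$, $h\sim g$ means $hg^{ -1}\prec h$. -}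

module Defs where

open import Level using (Level; _⊔_; suc)
open import Algebra.Bundles using (Group)
open import Relation.Binary.Structures using (IsStrictTotalOrder)
open import Relation.Nullary using (¬_)
open import Data.Sum using (_⊎_)
open import Data.Product using (_×_; ∃-syntax)

record OrderedGroup (c ℓ₁ ℓ₂ : Level) : Set (suc (c ⊔ ℓ₁ ⊔ ℓ₂)) where
  field
    group : Group c ℓ₁
  open Group group public
  field
    _<_ : Carrier → Carrier → Set ℓ₂
    isStrictTotalOrder : IsStrictTotalOrder _≈_ _<_
    <-compatˡ : ∀ f {g h} → h < g → (f ∙ h) < (f ∙ g)
    <-compatʳ : ∀ f {g h} → h < g → (h ∙ f) < (g ∙ f)

module _ {c ℓ₁ ℓ₂} (𝒢 : OrderedGroup c ℓ₁ ℓ₂) where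
  open OrderedGroup 𝒢

  _≤_ : Carrier → Carrier → Set (ℓ₁ ⊔ ℓ₂)
  f ≤ g = (f < g) ⊎ (f ≈ g)

  InC : Carrier → Carrier → Set ℓ₁
  InC g h = (h ∙ g) ≈ (g ∙ h)

  GOG1 : Set (c ⊔ ℓ₁ ⊔ ℓ₂)
  GOG1 = ∀ f g → ε < f → ε < g → g ≤ f →
         ∀ g₀ → InC g g₀ → ∃[ f₀ ] (InC f f₀ × g₀ ≤ f₀)

  _≼_ : Carrier → Carrier → Set (c ⊔ ℓ₁ ⊔ ℓ₂)
  f ≼ g = (f ≈ ε) ⊎ ((¬ (g ≈ ε)) × ∃[ g₀ ] ∃[ g₁ ] (InC g g₀ × InC g g₁ × g₀ ≤ f × f ≤ g₁))

  _≺_ : Carrier → Carrier → Set (c ⊔ ℓ₁ ⊔ ℓ₂)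
  f ≺ g = (f ≼ g) × ¬ (g ≼ f)

  _∼_ : Carrier → Carrier → Set (c ⊔ ℓ₁ ⊔ ℓ₂)
  h ∼ g = (h ∙ (g ⁻¹)) ≺ h

  SimClass : Carrier → Carrier → Set (c ⊔ ℓ₁ ⊔ ℓ₂)
  SimClass g h = (¬ (h ≈ ε)) × (h ∼ g)

  Convex : ∀ {p} → (Carrier → Set p) → Set (c ⊔ ℓ₂ ⊔ p)
  Convex S = ∀ a b x → S a → S b → a < x → x < b → S x

{-# OPTIONS --safe #-}
-- For k ≉ 1, u ≼ k says that u lies in the order-convex hull of the centralizer 𝒞(k).
-- Applied to c and c⁻¹, GOG1 says that this hull grows with k on the positive side,
-- and, passing to inverses (𝒞(k⁻¹) = 𝒞(k)), as k decreases on the negative side.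
-- Since k = h g⁻¹ commutes with itself, h lies in the hull of 𝒞(k) iff g does.
--
-- Let a < x < b with a, b ∼ g.  If h ∼ g then h has the sign of g, for otherwise
-- h lies strictly between 1 and h g⁻¹, whence h ≼ h g⁻¹; so a, x, b all have the sign
-- of g.  If x ≼ x g⁻¹, then g is in the hull of 𝒞(x g⁻¹), hence, by monotonicity, in
-- that of 𝒞(b g⁻¹) or of 𝒞(a g⁻¹) according to the sign of x g⁻¹; this gives
-- b ≼ b g⁻¹ or a ≼ a g⁻¹, which is excluded.  Finally x g⁻¹ ≼ x because x g⁻¹ lies
-- between x and a g⁻¹ (resp. b g⁻¹), and the latter is in the hull of 𝒞(a) ⊆ hull of
-- 𝒞(x) (resp. of 𝒞(b) ⊆ hull of 𝒞(x)).
module Submission where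

open import Defs hiding (_≤_)
open import Relation.Nullary using (¬_)
open import Level using (_⊔_)
open import Data.Sum using (inj₁; inj₂)
open import Data.Product using (_×_; _,_; ∃-syntax)
open import Data.Empty using (⊥-elim)
open import Function using (_∘_)
open import Relation.Binary.Definitions using (Tri; tri<; tri≈; tri>)
open import Relation.Binary.Structures using (IsStrictTotalOrder)
import Algebra.Properties.Group as GroupProperties
import Relation.Binary.Construct.StrictToNonStrict as StrictToNonStrict
import Relation.Binary.Reasoning.Setoid as SetoidReasoning

module OrderedGroupProperties {c ℓ₁ ℓ₂} (𝒢 : OrderedGroup c ℓ₁ ℓ₂) where

  open OrderedGroup 𝒢 public hiding (_<_)

  -- Rebound only to give them a fixity; Defs declares none.
  infix 4 _<_ _≤_
  _<_ : Carrier → Carrier → Set ℓ₂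
  _<_ = OrderedGroup._<_ 𝒢

  _≤_ : Carrier → Carrier → Set (ℓ₁ ⊔ ℓ₂)
  _≤_ = Defs._≤_ 𝒢

  open IsStrictTotalOrder isStrictTotalOrder public
    using (compare; irrefl; <-resp-≈; <-respˡ-≈; <-respʳ-≈) renaming (trans to <-trans)
  open GroupProperties group
    using (ε⁻¹≈ε; ⁻¹-involutive; \\-leftDividesʳ; //-rightDividesˡ; //-rightDividesʳ)
  open SetoidReasoning setoid

  ≤-trans : ∀ {u v w} → u ≤ v → v ≤ w → u ≤ w
  ≤-trans = StrictToNonStrict.trans _≈_ _<_ isEquivalence <-resp-≈ <-trans

  <-≤-trans : ∀ {u v w} → u < v → v ≤ w → u < w
  <-≤-trans = StrictToNonStrict.<-≤-trans _≈_ _<_ <-trans <-respʳ-≈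

  ≤-respʳ-≈ : ∀ {u v w} → v ≈ w → u ≤ v → u ≤ w
  ≤-respʳ-≈ = StrictToNonStrict.≤-respʳ-≈ _≈_ _<_ trans <-respʳ-≈

  ≤-respˡ-≈ : ∀ {u v w} → u ≈ v → u ≤ w → v ≤ w
  ≤-respˡ-≈ = StrictToNonStrict.≤-respˡ-≈ _≈_ _<_ sym trans <-respˡ-≈

  ≤-refl : ∀ {u} → u ≤ u
  ≤-refl = inj₂ refl

  <⇒≉ : ∀ {u v} → u < v → ¬ u ≈ v
  <⇒≉ u<v u≈v = irrefl u≈v u<v

  >⇒≉ : ∀ {u v} → v < u → ¬ u ≈ v
  >⇒≉ v<u u≈v = irrefl (sym u≈v) v<u

  ⁻¹-anti-mono : ∀ {u v} → u < v → v ⁻¹ < u ⁻¹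
  ⁻¹-anti-mono {u} {v} u<v =
    <-respˡ-≈ (\\-leftDividesʳ u (v ⁻¹))
      (<-respʳ-≈ u⁻¹vv⁻¹≈u⁻¹ (<-compatˡ (u ⁻¹) (<-compatʳ (v ⁻¹) u<v)))
    where
    u⁻¹vv⁻¹≈u⁻¹ : u ⁻¹ ∙ (v ∙ v ⁻¹) ≈ u ⁻¹
    u⁻¹vv⁻¹≈u⁻¹ = trans (∙-congˡ (inverseʳ v)) (identityʳ (u ⁻¹))

  ⁻¹-anti-mono-≤ : ∀ {u v} → u ≤ v → v ⁻¹ ≤ u ⁻¹
  ⁻¹-anti-mono-≤ (inj₁ u<v) = inj₁ (⁻¹-anti-mono u<v)
  ⁻¹-anti-mono-≤ (inj₂ u≈v) = inj₂ (⁻¹-cong (sym u≈v))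

  u⁻¹≤v⇒v⁻¹≤u : ∀ {u v} → u ⁻¹ ≤ v → v ⁻¹ ≤ u
  u⁻¹≤v⇒v⁻¹≤u {u} u⁻¹≤v = ≤-respʳ-≈ (⁻¹-involutive u) (⁻¹-anti-mono-≤ u⁻¹≤v)

  ε<u⇒u⁻¹<ε : ∀ {u} → ε < u → u ⁻¹ < ε
  ε<u⇒u⁻¹<ε ε<u = <-respʳ-≈ ε⁻¹≈ε (⁻¹-anti-mono ε<u)

  u<ε⇒ε<u⁻¹ : ∀ {u} → u < ε → ε < u ⁻¹
  u<ε⇒ε<u⁻¹ u<ε = <-respˡ-≈ ε⁻¹≈ε (⁻¹-anti-mono u<ε)

  u∙v⁻¹<u : ∀ u {v} → ε < v → u ∙ v ⁻¹ < u
  u∙v⁻¹<u u ε<v = <-respʳ-≈ (identityʳ u) (<-compatˡ u (ε<u⇒u⁻¹<ε ε<v))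

  u<u∙v⁻¹ : ∀ u {v} → v < ε → u < u ∙ v ⁻¹
  u<u∙v⁻¹ u v<ε = <-respˡ-≈ (identityʳ u) (<-compatˡ u (u<ε⇒ε<u⁻¹ v<ε))

  InC-self : ∀ k → InC 𝒢 k k
  InC-self k = refl

  InC-ε : ∀ k → InC 𝒢 k ε
  InC-ε k = trans (identityˡ k) (sym (identityʳ k))

  InC-∙ : ∀ {k u v} → InC 𝒢 k u → InC 𝒢 k v → InC 𝒢 k (u ∙ v)
  InC-∙ {k} {u} {v} uk≈ku vk≈kv = begin
    u ∙ v ∙ k   ≈⟨ assoc u v k ⟩
    u ∙ (v ∙ k) ≈⟨ ∙-congˡ vk≈kv ⟩
    u ∙ (k ∙ v) ≈⟨ assoc u k v ⟨
    u ∙ k ∙ v   ≈⟨ ∙-congʳ uk≈ku ⟩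
    k ∙ u ∙ v   ≈⟨ assoc k u v ⟩
    k ∙ (u ∙ v) ∎

  InC-⁻¹ : ∀ {k u} → InC 𝒢 k u → InC 𝒢 k (u ⁻¹)
  InC-⁻¹ {k} {u} uk≈ku = begin
    u ⁻¹ ∙ k                 ≈⟨ //-rightDividesʳ u (u ⁻¹ ∙ k) ⟨
    u ⁻¹ ∙ k ∙ u ∙ u ⁻¹      ≈⟨ ∙-congʳ (assoc (u ⁻¹) k u) ⟩
    u ⁻¹ ∙ (k ∙ u) ∙ u ⁻¹    ≈⟨ ∙-congʳ (∙-congˡ uk≈ku) ⟨
    u ⁻¹ ∙ (u ∙ k) ∙ u ⁻¹    ≈⟨ ∙-congʳ (\\-leftDividesʳ u k) ⟩
    k ∙ u ⁻¹                 ∎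

  InC⇒InC-of-⁻¹ : ∀ {k u} → InC 𝒢 k u → InC 𝒢 (k ⁻¹) u
  InC⇒InC-of-⁻¹ uk≈ku = sym (InC-⁻¹ (sym uk≈ku))

  InC-of-⁻¹⇒InC : ∀ {k u} → InC 𝒢 (k ⁻¹) u → InC 𝒢 k u
  InC-of-⁻¹⇒InC {k} {u} uk⁻¹≈k⁻¹u = begin
    u ∙ k           ≈⟨ ∙-congˡ (⁻¹-involutive k) ⟨
    u ∙ k ⁻¹ ⁻¹     ≈⟨ InC⇒InC-of-⁻¹ uk⁻¹≈k⁻¹u ⟩
    k ⁻¹ ⁻¹ ∙ u     ≈⟨ ∙-congʳ (⁻¹-involutive k) ⟩
    k ∙ u           ∎

  -- The bounds in the definition of _≼_, without its special case for k ≈ ε.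
  InHull : Carrier → Carrier → Set (c ⊔ ℓ₁ ⊔ ℓ₂)
  InHull k u = ∃[ c₀ ] ∃[ c₁ ] (InC 𝒢 k c₀ × InC 𝒢 k c₁ × c₀ ≤ u × u ≤ c₁)

  ≼⇒InHull : ∀ {u k} → _≼_ 𝒢 u k → InHull k u
  ≼⇒InHull {u} {k} (inj₁ u≈ε) = ε , ε , InC-ε k , InC-ε k , inj₂ (sym u≈ε) , inj₂ u≈ε
  ≼⇒InHull (inj₂ (_ , u∈hull)) = u∈hull

  InHull⇒≼ : ∀ {u k} → ¬ k ≈ ε → InHull k u → _≼_ 𝒢 u k
  InHull⇒≼ k≉ε u∈hull = inj₂ (k≉ε , u∈hull)

  InC⇒InHull : ∀ {k u} → InC 𝒢 k u → InHull k u
  InC⇒InHull {u = u} u∈C = u , u , u∈C , u∈C , ≤-refl , ≤-refl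

  InHull-convex : ∀ {k u v w} → InHull k u → InHull k v → u ≤ w → w ≤ v → InHull k w
  InHull-convex (c₀ , _ , c₀∈C , _ , c₀≤u , _) (_ , c₁ , _ , c₁∈C , _ , v≤c₁) u≤w w≤v =
    c₀ , c₁ , c₀∈C , c₁∈C , ≤-trans c₀≤u u≤w , ≤-trans w≤v v≤c₁

  InHull-between : ∀ {k u} → ε ≤ u → u ≤ k → InHull k u
  InHull-between {k} = InHull-convex (InC⇒InHull (InC-ε k)) (InC⇒InHull (InC-self k))

  InHull-between⁻ : ∀ {k u} → k ≤ u → u ≤ ε → InHull k u
  InHull-between⁻ {k} = InHull-convex (InC⇒InHull (InC-self k)) (InC⇒InHull (InC-ε k))

  InHull-mono : ∀ {k k′ u} → (∀ {c} → InC 𝒢 k c → InHull k′ c) → InHull k u → InHull k′ u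
  InHull-mono C⊆hull (_ , _ , c₀∈C , c₁∈C , c₀≤u , u≤c₁) =
    InHull-convex (C⊆hull c₀∈C) (C⊆hull c₁∈C) c₀≤u u≤c₁

  InHull-resp-≈ : ∀ {k u v} → u ≈ v → InHull k u → InHull k v
  InHull-resp-≈ u≈v (c₀ , c₁ , c₀∈C , c₁∈C , c₀≤u , u≤c₁) =
    c₀ , c₁ , c₀∈C , c₁∈C , ≤-respʳ-≈ u≈v c₀≤u , ≤-respˡ-≈ u≈v u≤c₁

  InHull⇒InHull-of-⁻¹ : ∀ {k u} → InHull k u → InHull (k ⁻¹) u
  InHull⇒InHull-of-⁻¹ = InHull-mono (InC⇒InHull ∘ InC⇒InC-of-⁻¹)

  InHull-of-⁻¹⇒InHull : ∀ {k u} → InHull (k ⁻¹) u → InHull k u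
  InHull-of-⁻¹⇒InHull = InHull-mono (InC⇒InHull ∘ InC-of-⁻¹⇒InC)

  InHull-mulˡ : ∀ {k m u} → InC 𝒢 k m → InHull k u → InHull k (m ∙ u)
  InHull-mulˡ {m = m} m∈C (c₀ , c₁ , c₀∈C , c₁∈C , c₀≤u , u≤c₁) =
    m ∙ c₀ , m ∙ c₁ , InC-∙ m∈C c₀∈C , InC-∙ m∈C c₁∈C , ∙-monoˡ c₀≤u , ∙-monoˡ u≤c₁
    where
    ∙-monoˡ : ∀ {v w} → v ≤ w → m ∙ v ≤ m ∙ w
    ∙-monoˡ (inj₁ v<w) = inj₁ (<-compatˡ m v<w)
    ∙-monoˡ (inj₂ v≈w) = inj₂ (∙-congˡ v≈w)

  ≼⇒≉ε : ∀ {u k} → ¬ u ≈ ε → _≼_ 𝒢 u k → ¬ k ≈ ε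
  ≼⇒≉ε u≉ε (inj₁ u≈ε) = ⊥-elim (u≉ε u≈ε)
  ≼⇒≉ε u≉ε (inj₂ (k≉ε , _)) = k≉ε

  InHull-dividend⇒divisor : ∀ {h g} → InHull (h ∙ g ⁻¹) h → InHull (h ∙ g ⁻¹) g
  InHull-dividend⇒divisor {h} {g} =
    InHull-resp-≈ k⁻¹h≈g ∘ InHull-mulˡ (InC-⁻¹ (InC-self (h ∙ g ⁻¹)))
    where
    k⁻¹h≈g : (h ∙ g ⁻¹) ⁻¹ ∙ h ≈ g
    k⁻¹h≈g = begin
      (h ∙ g ⁻¹) ⁻¹ ∙ h               ≈⟨ ∙-congˡ (//-rightDividesˡ g h) ⟨
      (h ∙ g ⁻¹) ⁻¹ ∙ (h ∙ g ⁻¹ ∙ g)  ≈⟨ \\-leftDividesʳ (h ∙ g ⁻¹) g ⟩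
      g                               ∎

  InHull-divisor⇒dividend : ∀ {h g} → InHull (h ∙ g ⁻¹) g → InHull (h ∙ g ⁻¹) h
  InHull-divisor⇒dividend {h} {g} =
    InHull-resp-≈ (//-rightDividesˡ g h) ∘ InHull-mulˡ (InC-self (h ∙ g ⁻¹))

  ∼-sign⁺ : ∀ {g h} → ε < g → ¬ h ≈ ε → _∼_ 𝒢 h g → ε < h
  ∼-sign⁺ {g} {h} ε<g h≉ε (_ , h⋠hg⁻¹) with compare h ε
  ... | tri> _ _ ε<h = ε<h
  ... | tri≈ _ h≈ε _ = ⊥-elim (h≉ε h≈ε)
  ... | tri< h<ε _ _ = ⊥-elim (h⋠hg⁻¹ (InHull⇒≼ (<⇒≉ (<-trans hg⁻¹<h h<ε))
                                         (InHull-between⁻ (inj₁ hg⁻¹<h) (inj₁ h<ε))))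
    where
    hg⁻¹<h : h ∙ g ⁻¹ < h
    hg⁻¹<h = u∙v⁻¹<u h ε<g

  ∼-sign⁻ : ∀ {g h} → g < ε → ¬ h ≈ ε → _∼_ 𝒢 h g → h < ε
  ∼-sign⁻ {g} {h} g<ε h≉ε (_ , h⋠hg⁻¹) with compare h ε
  ... | tri< h<ε _ _ = h<ε
  ... | tri≈ _ h≈ε _ = ⊥-elim (h≉ε h≈ε)
  ... | tri> _ _ ε<h = ⊥-elim (h⋠hg⁻¹ (InHull⇒≼ (>⇒≉ (<-trans ε<h h<hg⁻¹))
                                         (InHull-between (inj₁ ε<h) (inj₁ h<hg⁻¹))))
    where
    h<hg⁻¹ : h < h ∙ g ⁻¹
    h<hg⁻¹ = u<u∙v⁻¹ h g<ε

  module _ (gog1 : GOG1 𝒢) where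

    InC⇒InHull-mono⁺ : ∀ {k k′ c} → ε < k → k ≤ k′ → InC 𝒢 k c → InHull k′ c
    InC⇒InHull-mono⁺ {k} {k′} {c} ε<k k≤k′ c∈C
      with gog1 k′ k ε<k′ ε<k k≤k′ (c ⁻¹) (InC-⁻¹ c∈C) | gog1 k′ k ε<k′ ε<k k≤k′ c c∈C
      where ε<k′ = <-≤-trans ε<k k≤k′
    ... | f₀ , f₀∈C , c⁻¹≤f₀ | f₁ , f₁∈C , c≤f₁ =
      f₀ ⁻¹ , f₁ , InC-⁻¹ f₀∈C , f₁∈C , u⁻¹≤v⇒v⁻¹≤u c⁻¹≤f₀ , c≤f₁

    InHull-mono⁺ : ∀ {k k′ u} → ε < k → k ≤ k′ → InHull k u → InHull k′ u
    InHull-mono⁺ ε<k k≤k′ = InHull-mono (InC⇒InHull-mono⁺ ε<k k≤k′)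

    InHull-mono⁻ : ∀ {k k′ u} → k′ ≤ k → k < ε → InHull k u → InHull k′ u
    InHull-mono⁻ k′≤k k<ε =
      InHull-of-⁻¹⇒InHull
      ∘ InHull-mono⁺ (u<ε⇒ε<u⁻¹ k<ε) (⁻¹-anti-mono-≤ k′≤k)
      ∘ InHull⇒InHull-of-⁻¹

    divisor∉InHull-between : ∀ {g a b x} → a < x → x < b →
      ¬ _≼_ 𝒢 a (a ∙ g ⁻¹) → ¬ _≼_ 𝒢 b (b ∙ g ⁻¹) →
      ¬ x ∙ g ⁻¹ ≈ ε → ¬ InHull (x ∙ g ⁻¹) g
    divisor∉InHull-between {g} {a} {b} {x} a<x x<b a⋠a′ b⋠b′ x′≉ε g∈hull
      with compare (x ∙ g ⁻¹) ε
    ... | tri≈ _ x′≈ε _ = x′≉ε x′≈ε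
    ... | tri< x′<ε _ _ =
      a⋠a′ (InHull⇒≼ (<⇒≉ (<-trans a′<x′ x′<ε))
        (InHull-divisor⇒dividend (InHull-mono⁻ (inj₁ a′<x′) x′<ε g∈hull)))
      where
      a′<x′ : a ∙ g ⁻¹ < x ∙ g ⁻¹
      a′<x′ = <-compatʳ (g ⁻¹) a<x
    ... | tri> _ _ ε<x′ =
      b⋠b′ (InHull⇒≼ (>⇒≉ (<-trans ε<x′ x′<b′))
        (InHull-divisor⇒dividend (InHull-mono⁺ ε<x′ (inj₁ x′<b′) g∈hull)))
      where
      x′<b′ : x ∙ g ⁻¹ < b ∙ g ⁻¹
      x′<b′ = <-compatʳ (g ⁻¹) x<b

    ⋠-between : ∀ {g a b x} → ¬ x ≈ ε → a < x → x < b →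
      ¬ _≼_ 𝒢 a (a ∙ g ⁻¹) → ¬ _≼_ 𝒢 b (b ∙ g ⁻¹) → ¬ _≼_ 𝒢 x (x ∙ g ⁻¹)
    ⋠-between x≉ε a<x x<b a⋠a′ b⋠b′ x≼x′ =
      divisor∉InHull-between a<x x<b a⋠a′ b⋠b′ (≼⇒≉ε x≉ε x≼x′)
        (InHull-dividend⇒divisor (≼⇒InHull x≼x′))

    SimClass-convex⁺ : ∀ {g} → ε < g → Convex 𝒢 (SimClass 𝒢 g)
    SimClass-convex⁺ {g} ε<g a b x (a≉ε , a∼g@(a′≼a , a⋠a′)) (_ , _ , b⋠b′) a<x x<b =
      >⇒≉ ε<x , InHull⇒≼ (>⇒≉ ε<x) x′∈hull , ⋠-between (>⇒≉ ε<x) a<x x<b a⋠a′ b⋠b′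
      where
      ε<a : ε < a
      ε<a = ∼-sign⁺ ε<g a≉ε a∼g
      ε<x : ε < x
      ε<x = <-trans ε<a a<x
      x′∈hull : InHull x (x ∙ g ⁻¹)
      x′∈hull = InHull-convex
        (InHull-mono⁺ ε<a (inj₁ a<x) (≼⇒InHull a′≼a)) (InC⇒InHull (InC-self x))
        (inj₁ (<-compatʳ (g ⁻¹) a<x)) (inj₁ (u∙v⁻¹<u x ε<g))

    SimClass-convex⁻ : ∀ {g} → g < ε → Convex 𝒢 (SimClass 𝒢 g)
    SimClass-convex⁻ {g} g<ε a b x (_ , _ , a⋠a′) (b≉ε , b∼g@(b′≼b , b⋠b′)) a<x x<b =
      <⇒≉ x<ε , InHull⇒≼ (<⇒≉ x<ε) x′∈hull , ⋠-between (<⇒≉ x<ε) a<x x<b a⋠a′ b⋠b′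
      where
      b<ε : b < ε
      b<ε = ∼-sign⁻ g<ε b≉ε b∼g
      x<ε : x < ε
      x<ε = <-trans x<b b<ε
      x′∈hull : InHull x (x ∙ g ⁻¹)
      x′∈hull = InHull-convex
        (InC⇒InHull (InC-self x)) (InHull-mono⁻ (inj₁ x<b) b<ε (≼⇒InHull b′≼b))
        (inj₁ (u<u∙v⁻¹ x g<ε)) (inj₁ (<-compatʳ (g ⁻¹) x<b))

proposition2p14 : ∀ {c ℓ₁ ℓ₂} (𝒢 : OrderedGroup c ℓ₁ ℓ₂) → GOG1 𝒢 →
    (g : OrderedGroup.Carrier 𝒢) → ¬ (OrderedGroup._≈_ 𝒢 g (OrderedGroup.ε 𝒢)) →
    Convex 𝒢 (SimClass 𝒢 g)
proposition2p14 𝒢 gog1 g g≉ε = by-sign (compare ε g)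
  where
  open OrderedGroupProperties 𝒢

  by-sign : Tri (ε < g) (ε ≈ g) (g < ε) → Convex 𝒢 (SimClass 𝒢 g)
  by-sign (tri< ε<g _ _) = SimClass-convex⁺ gog1 ε<g
  by-sign (tri≈ _ ε≈g _) = ⊥-elim (g≉ε (sym ε≈g))
  by-sign (tri> _ _ g<ε) = SimClass-convex⁻ gog1 g<ε
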